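{- Let $G_1=(V_1,E_1)$ be a finite simple graph of maximum degree $\Delta_1$ and let $G_2=(V_2,E_2)$ be a finite simple $\delta_2$-regular graph. Let $S_1\subseteq V_1$. For every integer $k\in\{\delta_2-\Delta_1,\dots,\Delta_1+\delta_2\}$, the set $S_1\times V_2$ is a $k$-daf set in $G_1\times G_2$ if and only if $S_1$ is a $(k-\delta_2)$-daf set in $G_1$.
   Context: For a graph $G=(V,E)$, a set $S\subseteq V$ and $v\in V$, $\delta_S(v)=|\{u\in S: uv\in E\}|$ and $\overline{S}=V\setminus S$. For an integer $k$, a non-empty set $S\subseteq V$ is a defensive $k$-alliance if $\delta_S(v)\ge \delta_{\overline{S}}(v)+k$ for every $v\in S$. A set $X\subseteq V$ is defensive $k$-alliance free ($k$-daf) if $X$ contains no defensive $k$-alliance as a subset. The Cartesian product $G_1\times G_2$ has vertex set $V_1\times V_2$, with $(a,b)$ adjacent to $(c,d)$ iff either $a=c$ and $bd\in E_2$, or $b=d$ and $ac\in E_1$. -}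

module Defs where

open import Data.Nat using (ℕ; suc; _≤_; _⊔_)
open import Data.Bool using (Bool; true; false; _∧_; _∨_)
open import Data.Fin using (Fin; remQuot; _≟_)
open import Data.Fin.Subset using (Subset; _∈_; _⊆_; _∩_; ∁; ∣_∣; Nonempty)
open import Data.Vec using (tabulate; lookup)
open import Data.List using (foldr; map; allFin)
open import Data.Product using (_×_; proj₁; proj₂)
open import Data.Integer as ℤ using (ℤ; +_)
open import Relation.Nullary using (¬_)
open import Relation.Nullary.Decidable using (⌊_⌋)
open import Relation.Binary.PropositionalEquality using (_≡_)

record Graph : Set where
  field
    n   : ℕ
    adj : Fin n → Fin n → Bool
open Graph public

-- finite simple graph: symmetric adjacency, no loops (Bool rules out multi-edges)
Simple : Graph → Set
Simple G = (∀ u v → adj G u v ≡ adj G v u) × (∀ v → adj G v v ≡ false)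

nbhd : (G : Graph) → Fin (n G) → Subset (n G)
nbhd G v = tabulate (λ u → adj G u v)

δ : (G : Graph) → Subset (n G) → Fin (n G) → ℕ
δ G S v = ∣ S ∩ nbhd G v ∣

deg : (G : Graph) → Fin (n G) → ℕ
deg G v = ∣ nbhd G v ∣

maxDeg : Graph → ℕ
maxDeg G = foldr _⊔_ 0 (map (deg G) (allFin (n G)))

Regular : Graph → ℕ → Set
Regular G d = ∀ v → deg G v ≡ d

IsDefAlliance : (G : Graph) → ℤ → Subset (n G) → Set
IsDefAlliance G k S =
  Nonempty S × (∀ v → v ∈ S → (+ δ G (∁ S) v) ℤ.+ k ℤ.≤ + δ G S v)

IsDaf : (G : Graph) → ℤ → Subset (n G) → Set
IsDaf G k X = ∀ S → S ⊆ X → ¬ IsDefAlliance G k S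

fstV : (G₁ G₂ : Graph) → Fin (n G₁ Data.Nat.* n G₂) → Fin (n G₁)
fstV G₁ G₂ x = proj₁ (remQuot {n G₁} (n G₂) x)

sndV : (G₁ G₂ : Graph) → Fin (n G₁ Data.Nat.* n G₂) → Fin (n G₂)
sndV G₁ G₂ x = proj₂ (remQuot {n G₁} (n G₂) x)

-- Cartesian product; vertex (a , b) is encoded as combine a b : Fin (n₁ * n₂)
_□_ : Graph → Graph → Graph
G₁ □ G₂ = record
  { n   = n G₁ Data.Nat.* n G₂
  ; adj = λ x y →
      let a = fstV G₁ G₂ x ; b = sndV G₁ G₂ x
          c = fstV G₁ G₂ y ; d = sndV G₁ G₂ y
      in (⌊ a ≟ c ⌋ ∧ adj G₂ b d) ∨ (⌊ b ≟ d ⌋ ∧ adj G₁ a c)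
  }

prodSet : (G₁ G₂ : Graph) → Subset (n G₁) → Subset (n (G₁ □ G₂))
prodSet G₁ G₂ S₁ = tabulate (λ x → lookup S₁ (fstV G₁ G₂ x))

module Submission where

-- Write a vertex of G₁ □ G₂ as (c , d) (encoded as combine c d).  A product
-- neighbour of (a , b) lies either in the row of a, i.e. it is (a , d) with
-- d ~ b in G₂, or in the column of b, i.e. it is (c , b) with c ~ a in G₁,
-- and never in both because G₂ has no loops.  Hence for every vertex set T
--     δ_T(a , b) = δ_{row_a T}(b) + δ_{col_b T}(a)                  (δ-□)
-- where row_a T ⊆ V₂ and col_b T ⊆ V₁ are the slices of T through (a , b).
-- For T = A × V₂ and a ∈ A the slices are V₂ and A, and those of ∁T are ∅
-- and ∁A; so δ_T = δ₂ + δ_A(a) and δ_{∁T} = δ_{∁A}(a), and A × V₂ is a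
-- defensive k-alliance as soon as A is a defensive (k - δ₂)-alliance
-- (lift-alliance).  Conversely the shadow π₁(S) = {c : (c , d) ∈ S} of a
-- defensive k-alliance S is a defensive (k - δ₂)-alliance, because
-- col_b S ⊆ π₁(S) and row_a S ⊆ V₂ (shadow-alliance).  Each direction of
-- the daf equivalence is one of these two facts.

open import Defs
open import Data.Nat using (ℕ; suc; _≤_)
open import Data.Integer using (ℤ; +_; _-_; _+_)
open import Data.Fin.Subset using (Subset)
open import Data.Product using (_×_)
open import Function.Bundles using (_⇔_)
open import Relation.Binary.PropositionalEquality using (_≡_)

import Data.Nat as ℕ
import Data.Nat.Properties as ℕP
import Data.Integer as ℤ
import Data.Integer.Properties as ℤP
open import Data.Integer.Tactic.RingSolver using (solve-∀)
open import Algebra.Properties.CommutativeMonoid.Sum ℕP.+-0-commutativeMonoid using (sum; sum-cong-≗; ∑-distrib-+; sum-replicate-zero)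
open import Data.Bool using (Bool; true; false; _∧_; _∨_; not)
open import Data.Bool.Properties using (∧-zeroʳ; T-≡)
open import Data.Fin using (Fin; zero; suc; combine; _↑ˡ_; _↑ʳ_; fromℕ<)
open import Data.Fin.Properties using (_≟_; suc-injective; remQuot-combine; combine-surjective)
open import Data.Fin.Subset using (_∈_; _⊆_; _∩_; ∁; ∣_∣; ⊤; ⊥; Nonempty)
open import Data.Fin.Subset.Properties using (p⊆q⇒∣p∣≤∣q∣; ∣p∩q∣≤∣q∣; x∈p∩q⁺; x∈p∩q⁻; ∩-identityˡ; ∩-zeroˡ; ∣⊥∣≡0; nonempty?; p⊆q⇒∁p⊇∁q)
open import Data.Vec using ([]; _∷_; lookup; tabulate)
open import Data.Vec.Properties using (lookup-zipWith; lookup∘tabulate; tabulate∘lookup; tabulate-cong; tabulate-∘; lookup-map; lookup-replicate; map-replicate; []=⇒lookup; lookup⇒[]=)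
open import Data.Product using (_,_; proj₁; ∃)
open import Function using (_∘_; Equivalence; mk⇔)
open import Relation.Nullary using (yes; no; contradiction)
open import Relation.Nullary.Decidable using (⌊_⌋; toWitness; fromWitness)
open import Relation.Binary.PropositionalEquality using (_≢_; refl; sym; trans; cong; cong₂; subst₂; module ≡-Reasoning)

Loopless : Graph → Set
Loopless G = ∀ v → adj G v v ≡ false

𝟙 : Bool → ℕ
𝟙 true  = 1
𝟙 false = 0

sum-zero : ∀ {m} {f : Fin m → ℕ} → (∀ i → f i ≡ 0) → sum f ≡ 0
sum-zero {m} f≡0 = trans (sum-cong-≗ f≡0) (sum-replicate-zero m)

sum-point : ∀ {m} (a : Fin m) (f : Fin m → ℕ) → (∀ i → i ≢ a → f i ≡ 0) → sum f ≡ f a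
sum-point zero    f off = trans (cong (f zero ℕ.+_) (sum-zero λ i → off (suc i) λ ())) (ℕP.+-identityʳ (f zero))
sum-point (suc a) f off = trans (cong (ℕ._+ sum (f ∘ suc)) (off zero λ ()))
                                (sum-point a (f ∘ suc) λ i i≢a → off (suc i) (i≢a ∘ suc-injective))

guard-on : ∀ {m} (i : Fin m) t q → 𝟙 (t ∧ (⌊ i ≟ i ⌋ ∧ q)) ≡ 𝟙 (t ∧ q)
guard-on i t q with i ≟ i
... | yes _   = refl
... | no i≢i = contradiction refl i≢i

guard-off : ∀ {m} {i j : Fin m} t q → i ≢ j → 𝟙 (t ∧ (⌊ i ≟ j ⌋ ∧ q)) ≡ 0
guard-off {i = i} {j} t q i≢j with i ≟ j
... | yes i≡j = contradiction i≡j i≢j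
... | no _    = cong 𝟙 (∧-zeroʳ t)

sum-↑ : ∀ m {p} (f : Fin (m ℕ.+ p) → ℕ) → sum f ≡ sum {m} (λ i → f (i ↑ˡ p)) ℕ.+ sum {p} (λ j → f (m ↑ʳ j))
sum-↑ ℕ.zero f = refl
sum-↑ (suc m) f = trans (cong (f zero ℕ.+_) (sum-↑ m (f ∘ suc))) (sym (ℕP.+-assoc (f zero) _ _))

sum-combine : ∀ m {p} (f : Fin (m ℕ.* p) → ℕ) →
              sum f ≡ sum {m} (λ c → sum {p} (λ d → f (combine c d)))
sum-combine ℕ.zero f = refl
sum-combine (suc m) {p} f =
  trans (sum-↑ p f) (cong (sum {p} (λ d → f (d ↑ˡ m ℕ.* p)) ℕ.+_) (sum-combine m (λ x → f (p ↑ʳ x))))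

∣∣-sum : ∀ {m} (p : Subset m) → ∣ p ∣ ≡ sum (λ i → 𝟙 (lookup p i))
∣∣-sum []          = refl
∣∣-sum (true ∷ p)  = cong suc (∣∣-sum p)
∣∣-sum (false ∷ p) = ∣∣-sum p

δ-tabulate : ∀ G (f : Fin (n G) → Bool) v → δ G (tabulate f) v ≡ sum (λ u → 𝟙 (f u ∧ adj G u v))
δ-tabulate G f v = trans (∣∣-sum (tabulate f ∩ nbhd G v)) (sum-cong-≗ entry)
  where
  entry : ∀ u → 𝟙 (lookup (tabulate f ∩ nbhd G v) u) ≡ 𝟙 (f u ∧ adj G u v)
  entry u = cong 𝟙 (trans (lookup-zipWith _∧_ u (tabulate f) (nbhd G v))
                          (cong₂ _∧_ (lookup∘tabulate f u) (lookup∘tabulate (λ w → adj G w v) u)))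

δ-sum : ∀ G S v → δ G S v ≡ sum (λ u → 𝟙 (lookup S u ∧ adj G u v))
δ-sum G S v = trans (cong (λ S′ → δ G S′ v) (sym (tabulate∘lookup S))) (δ-tabulate G (lookup S) v)

δ-mono : ∀ G {S S′} v → S ⊆ S′ → δ G S v ≤ δ G S′ v
δ-mono G {S} v S⊆S′ = p⊆q⇒∣p∣≤∣q∣ λ x∈ → let (x∈S , x∈N) = x∈p∩q⁻ S (nbhd G v) x∈ in x∈p∩q⁺ (S⊆S′ x∈S , x∈N)

δ≤deg : ∀ G S v → δ G S v ≤ deg G v
δ≤deg G S v = ∣p∩q∣≤∣q∣ S (nbhd G v)

δ-⊤ : ∀ G v → δ G ⊤ v ≡ deg G v
δ-⊤ G v = cong ∣_∣ (∩-identityˡ (nbhd G v))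

δ-⊥ : ∀ G v → δ G ⊥ v ≡ 0
δ-⊥ G v = trans (cong ∣_∣ (∩-zeroˡ (nbhd G v))) (∣⊥∣≡0 (n G))

shift-≤ : ∀ (x y k d : ℤ) → x + (k - d) ℤ.≤ y → x + k ℤ.≤ d + y
shift-≤ x y k d h = begin
  x + k           ≡⟨ regroup x k d ⟩
  x + (k - d) + d ≤⟨ ℤP.+-monoˡ-≤ d h ⟩
  y + d           ≡⟨ ℤP.+-comm y d ⟩
  d + y           ∎
  where
  open ℤP.≤-Reasoning
  regroup : ∀ x k d → x + k ≡ x + (k - d) + d
  regroup = solve-∀

unshift-≤ : ∀ (x y k d : ℤ) → x + k ℤ.≤ d + y → x + (k - d) ℤ.≤ y
unshift-≤ x y k d h = begin
  x + (k - d)     ≡⟨ regroup x k d ⟩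
  x + k - d       ≤⟨ ℤP.+-monoˡ-≤ (ℤ.- d) h ⟩
  d + y - d       ≡⟨ cancel d y ⟩
  y               ∎
  where
  open ℤP.≤-Reasoning
  regroup : ∀ x k d → x + (k - d) ≡ x + k - d
  regroup = solve-∀
  cancel : ∀ d y → d + y - d ≡ y
  cancel = solve-∀

∈-tabulate⁺ : ∀ {m} {f : Fin m → Bool} {i} → f i ≡ true → i ∈ tabulate f
∈-tabulate⁺ {f = f} {i} fi = lookup⇒[]= i (tabulate f) (trans (lookup∘tabulate f i) fi)

∈-tabulate⁻ : ∀ {m} {f : Fin m → Bool} {i} → i ∈ tabulate f → f i ≡ true
∈-tabulate⁻ {f = f} {i} i∈ = trans (sym (lookup∘tabulate f i)) ([]=⇒lookup i∈)

tabulate-lookup : ∀ {m} {f : Fin m → Bool} (p : Subset m) → (∀ i → f i ≡ lookup p i) → tabulate f ≡ p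
tabulate-lookup p f≗p = trans (tabulate-cong f≗p) (tabulate∘lookup p)

∁⊤≡⊥ : ∀ {m} → ∁ (⊤ {m}) ≡ ⊥
∁⊤≡⊥ {m} = map-replicate not true m

-- Subsets of Fin m × Fin p, whose elements are encoded as combine c d.
module Slices (m p : ℕ) where

  row : Fin m → Subset (m ℕ.* p) → Subset p
  row a T = tabulate (λ d → lookup T (combine a d))

  col : Fin p → Subset (m ℕ.* p) → Subset m
  col b T = tabulate (λ c → lookup T (combine c b))

  row-∁ : ∀ a T → row a (∁ T) ≡ ∁ (row a T)
  row-∁ a T = trans (tabulate-cong λ d → lookup-map (combine a d) not T) (tabulate-∘ not _)

  col-∁ : ∀ b T → col b (∁ T) ≡ ∁ (col b T)
  col-∁ b T = trans (tabulate-cong λ c → lookup-map (combine c b) not T) (tabulate-∘ not _)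

  shadow : Subset (m ℕ.* p) → Subset m
  shadow T = tabulate (λ c → ⌊ nonempty? (row c T) ⌋)

  shadow-intro : ∀ {T c d} → combine c d ∈ T → c ∈ shadow T
  shadow-intro {T} {c} {d} cd∈T =
    ∈-tabulate⁺ (Equivalence.to T-≡ (fromWitness (d , ∈-tabulate⁺ ([]=⇒lookup cd∈T))))

  shadow-elim : ∀ {T c} → c ∈ shadow T → ∃ λ d → combine c d ∈ T
  shadow-elim {T} {c} c∈ with toWitness (Equivalence.from T-≡ (∈-tabulate⁻ c∈))
  ... | d , d∈row = d , lookup⇒[]= (combine c d) T (∈-tabulate⁻ d∈row)

  col⊆shadow : ∀ b T → col b T ⊆ shadow T
  col⊆shadow b T c∈ = shadow-intro (lookup⇒[]= (combine {m} {p} _ b) T (∈-tabulate⁻ c∈))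

module Product (G₁ G₂ : Graph) where

  open Slices (n G₁) (n G₂) public

  fstV-combine : ∀ c d → fstV G₁ G₂ (combine c d) ≡ c
  fstV-combine c d = cong proj₁ (remQuot-combine c d)

  adj-□ : ∀ c d a b → adj (G₁ □ G₂) (combine c d) (combine a b)
                     ≡ (⌊ c ≟ a ⌋ ∧ adj G₂ d b) ∨ (⌊ d ≟ b ⌋ ∧ adj G₁ c a)
  adj-□ c d a b = cong₂ adj′ (remQuot-combine c d) (remQuot-combine a b)
    where
    adj′ : Fin (n G₁) × Fin (n G₂) → Fin (n G₁) × Fin (n G₂) → Bool
    adj′ (c , d) (a , b) = (⌊ c ≟ a ⌋ ∧ adj G₂ d b) ∨ (⌊ d ≟ b ⌋ ∧ adj G₁ c a)

  lookup-prodSet : ∀ A c d → lookup (prodSet G₁ G₂ A) (combine c d) ≡ lookup A c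
  lookup-prodSet A c d = trans (lookup∘tabulate _ (combine c d)) (cong (lookup A) (fstV-combine c d))

  ∈-prodSet⁺ : ∀ {A c} d → c ∈ A → combine c d ∈ prodSet G₁ G₂ A
  ∈-prodSet⁺ {A} {c} d c∈A = lookup⇒[]= _ _ (trans (lookup-prodSet A c d) ([]=⇒lookup c∈A))

  ∈-prodSet⁻ : ∀ {A c d} → combine c d ∈ prodSet G₁ G₂ A → c ∈ A
  ∈-prodSet⁻ {A} {c} {d} cd∈ = lookup⇒[]= c A (trans (sym (lookup-prodSet A c d)) ([]=⇒lookup cd∈))

  prodSet-mono : ∀ {A B} → A ⊆ B → prodSet G₁ G₂ A ⊆ prodSet G₁ G₂ B
  prodSet-mono {A} {B} A⊆B x∈ = ∈-tabulate⁺ ([]=⇒lookup (A⊆B (lookup⇒[]= _ A (∈-tabulate⁻ x∈))))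

  row-prodSet : ∀ {A a} → a ∈ A → row a (prodSet G₁ G₂ A) ≡ ⊤
  row-prodSet {A} {a} a∈A = tabulate-lookup ⊤ λ d →
    trans (trans (lookup-prodSet A a d) ([]=⇒lookup a∈A)) (sym (lookup-replicate d true))

  col-prodSet : ∀ A b → col b (prodSet G₁ G₂ A) ≡ A
  col-prodSet A b = tabulate-lookup A λ c → lookup-prodSet A c b

  shadow-⊆ : ∀ {S A} → S ⊆ prodSet G₁ G₂ A → shadow S ⊆ A
  shadow-⊆ S⊆ c∈ with shadow-elim c∈
  ... | d , cd∈S = ∈-prodSet⁻ (S⊆ cd∈S)

  ∑₁ : (Fin (n G₁) → ℕ) → ℕ
  ∑₁ = sum

  ∑₂ : (Fin (n G₂) → ℕ) → ℕ
  ∑₂ = sum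

  rowTerm : Subset (n G₁ ℕ.* n G₂) → Fin (n G₁) → Fin (n G₂) → Fin (n G₁) → Fin (n G₂) → ℕ
  rowTerm T a b c d = 𝟙 (lookup T (combine c d) ∧ (⌊ c ≟ a ⌋ ∧ adj G₂ d b))

  colTerm : Subset (n G₁ ℕ.* n G₂) → Fin (n G₁) → Fin (n G₂) → Fin (n G₁) → Fin (n G₂) → ℕ
  colTerm T a b c d = 𝟙 (lookup T (combine c d) ∧ (⌊ d ≟ b ⌋ ∧ adj G₁ c a))

  -- From here on G₂ has no loops, so row and column neighbours never coincide.
  module _ (loopless : Loopless G₂) where

    row-col-disjoint : ∀ (c a : Fin (n G₁)) (d b : Fin (n G₂)) →
                       ⌊ c ≟ a ⌋ ∧ ⌊ d ≟ b ⌋ ∧ adj G₂ d b ≡ false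
    row-col-disjoint c a d b with c ≟ a | d ≟ b
    ... | yes _ | yes refl = loopless d
    ... | yes _ | no _     = refl
    ... | no _  | _        = refl

    neighbour-split : ∀ T a b c d →
      𝟙 (lookup T (combine c d) ∧ adj (G₁ □ G₂) (combine c d) (combine a b)) ≡ rowTerm T a b c d ℕ.+ colTerm T a b c d
    neighbour-split T a b c d =
      trans (cong (λ e → 𝟙 (lookup T (combine c d) ∧ e)) (adj-□ c d a b))
            (𝟙-split _ ⌊ c ≟ a ⌋ ⌊ d ≟ b ⌋ _ _ (row-col-disjoint c a d b))
      where
      𝟙-split : ∀ t e f p q → e ∧ f ∧ p ≡ false →
                𝟙 (t ∧ ((e ∧ p) ∨ (f ∧ q))) ≡ 𝟙 (t ∧ (e ∧ p)) ℕ.+ 𝟙 (t ∧ (f ∧ q))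
      𝟙-split false e     f     p     q _ = refl
      𝟙-split true  false f     p     q _ = refl
      𝟙-split true  true  false false q _ = refl
      𝟙-split true  true  false true  q _ = refl
      𝟙-split true  true  true  false q _ = refl
      𝟙-split true  true  true  true  q ()

    δ-□ : ∀ T a b →
          δ (G₁ □ G₂) T (combine a b) ≡ δ G₂ (row a T) b ℕ.+ δ G₁ (col b T) a
    δ-□ T a b = begin
      δ (G₁ □ G₂) T (combine a b)
        ≡⟨ δ-sum (G₁ □ G₂) T (combine a b) ⟩
      sum {n G₁ ℕ.* n G₂} (λ x → 𝟙 (lookup T x ∧ adj (G₁ □ G₂) x (combine a b)))
        ≡⟨ sum-combine (n G₁) _ ⟩
      ∑₁ (λ c → ∑₂ (λ d → 𝟙 (lookup T (combine c d) ∧ adj (G₁ □ G₂) (combine c d) (combine a b))))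
        ≡⟨ sum-cong-≗ (λ c → trans (sum-cong-≗ (neighbour-split T a b c)) (∑-distrib-+ (rowTerm T a b c) _)) ⟩
      ∑₁ (λ c → ∑₂ (rowTerm T a b c) ℕ.+ ∑₂ (colTerm T a b c))
        ≡⟨ ∑-distrib-+ (λ c → ∑₂ (rowTerm T a b c)) _ ⟩
      ∑₁ (λ c → ∑₂ (rowTerm T a b c)) ℕ.+ ∑₁ (λ c → ∑₂ (colTerm T a b c))
        ≡⟨ cong₂ ℕ._+_ row-count col-count ⟩
      δ G₂ (row a T) b ℕ.+ δ G₁ (col b T) a ∎
      where
      open ≡-Reasoning
      -- only the row c = a contributes row terms
      row-count : ∑₁ (λ c → ∑₂ (rowTerm T a b c)) ≡ δ G₂ (row a T) b
      row-count = begin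
        ∑₁ (λ c → ∑₂ (rowTerm T a b c))
          ≡⟨ sum-point a _ (λ c c≢a → sum-zero λ d → guard-off (lookup T (combine c d)) (adj G₂ d b) c≢a) ⟩
        ∑₂ (rowTerm T a b a)
          ≡⟨ sum-cong-≗ (λ d → guard-on a (lookup T (combine a d)) (adj G₂ d b)) ⟩
        ∑₂ (λ d → 𝟙 (lookup T (combine a d) ∧ adj G₂ d b))
          ≡⟨ sym (δ-tabulate G₂ _ b) ⟩
        δ G₂ (row a T) b ∎
      -- in each row only the column d = b contributes column terms
      col-count : ∑₁ (λ c → ∑₂ (colTerm T a b c)) ≡ δ G₁ (col b T) a
      col-count = begin
        ∑₁ (λ c → ∑₂ (colTerm T a b c))
          ≡⟨ sum-cong-≗ (λ c → trans (sum-point b (colTerm T a b c) λ d d≢b → guard-off (lookup T (combine c d)) (adj G₁ c a) d≢b)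
                                     (guard-on b (lookup T (combine c b)) (adj G₁ c a))) ⟩
        ∑₁ (λ c → 𝟙 (lookup T (combine c b) ∧ adj G₁ c a))
          ≡⟨ sym (δ-tabulate G₁ _ a) ⟩
        δ G₁ (col b T) a ∎

    δ-prodSet : ∀ {δ₂} → Regular G₂ δ₂ → ∀ {A a} b → a ∈ A →
                δ (G₁ □ G₂) (prodSet G₁ G₂ A) (combine a b) ≡ δ₂ ℕ.+ δ G₁ A a
    δ-prodSet {δ₂} regular {A} {a} b a∈A = begin
      δ (G₁ □ G₂) T (combine a b)            ≡⟨ δ-□ T a b ⟩
      δ G₂ (row a T) b ℕ.+ δ G₁ (col b T) a  ≡⟨ cong₂ (λ R C → δ G₂ R b ℕ.+ δ G₁ C a) (row-prodSet a∈A) (col-prodSet A b) ⟩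
      δ G₂ ⊤ b ℕ.+ δ G₁ A a                  ≡⟨ cong (ℕ._+ δ G₁ A a) (trans (δ-⊤ G₂ b) (regular b)) ⟩
      δ₂ ℕ.+ δ G₁ A a                        ∎
      where
      open ≡-Reasoning
      T = prodSet G₁ G₂ A

    δ-∁prodSet : ∀ {A a} b → a ∈ A →
                 δ (G₁ □ G₂) (∁ (prodSet G₁ G₂ A)) (combine a b) ≡ δ G₁ (∁ A) a
    δ-∁prodSet {A} {a} b a∈A = begin
      δ (G₁ □ G₂) (∁ T) (combine a b)                ≡⟨ δ-□ (∁ T) a b ⟩
      δ G₂ (row a (∁ T)) b ℕ.+ δ G₁ (col b (∁ T)) a  ≡⟨ cong₂ (λ R C → δ G₂ R b ℕ.+ δ G₁ C a) row-∁T col-∁T ⟩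
      δ G₂ ⊥ b ℕ.+ δ G₁ (∁ A) a                      ≡⟨ cong (ℕ._+ δ G₁ (∁ A) a) (δ-⊥ G₂ b) ⟩
      δ G₁ (∁ A) a                                   ∎
      where
      open ≡-Reasoning
      T = prodSet G₁ G₂ A
      row-∁T : row a (∁ T) ≡ ⊥
      row-∁T = trans (row-∁ a T) (trans (cong ∁ (row-prodSet a∈A)) ∁⊤≡⊥)
      col-∁T : col b (∁ T) ≡ ∁ A
      col-∁T = trans (col-∁ b T) (cong ∁ (col-prodSet A b))

    -- If A is a defensive (k - δ₂)-alliance of G₁ then A × V₂ is a defensive
    -- k-alliance of G₁ □ G₂ (non-empty because V₂ is).
    lift-alliance : ∀ {δ₂} → Regular G₂ δ₂ → 1 ≤ n G₂ →
                    ∀ {k A} → IsDefAlliance G₁ (k - + δ₂) A → IsDefAlliance (G₁ □ G₂) k (prodSet G₁ G₂ A)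
    lift-alliance {δ₂} regular V₂≢∅ {k} {A} ((a , a∈A) , A-defends) =
      (combine a (fromℕ< V₂≢∅) , ∈-prodSet⁺ _ a∈A) , defends
      where
      T = prodSet G₁ G₂ A
      defends : ∀ x → x ∈ T → + δ (G₁ □ G₂) (∁ T) x + k ℤ.≤ + δ (G₁ □ G₂) T x
      defends x x∈T with combine-surjective {n G₁} {n G₂} x
      ... | c , b , refl = subst₂ (λ out inn → + out + k ℤ.≤ + inn)
                                  (sym (δ-∁prodSet b c∈A)) (sym (δ-prodSet regular b c∈A))
                                  (shift-≤ (+ δ G₁ (∁ A) c) (+ δ G₁ A c) k (+ δ₂) (A-defends c c∈A))
        where
        c∈A : c ∈ A
        c∈A = ∈-prodSet⁻ x∈T

    -- If S is a defensive k-alliance of G₁ □ G₂ then its shadow is a defensive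
    -- (k - δ₂)-alliance of G₁: every slice of S lies in the shadow or in V₂.
    shadow-alliance : ∀ {δ₂} → Regular G₂ δ₂ →
                      ∀ {k S} → IsDefAlliance (G₁ □ G₂) k S → IsDefAlliance G₁ (k - + δ₂) (shadow S)
    shadow-alliance {δ₂} regular {k} {S} ((x , x∈S) , S-defends) = nonempty , defends
      where
      A = shadow S

      nonempty : Nonempty A
      nonempty with combine-surjective {n G₁} {n G₂} x
      ... | a , b , refl = a , shadow-intro x∈S

      outside-bound : ∀ a b → δ G₁ (∁ A) a ≤ δ (G₁ □ G₂) (∁ S) (combine a b)
      outside-bound a b = begin
        δ G₁ (∁ A) a                                   ≤⟨ δ-mono G₁ a ∁A⊆col ⟩
        δ G₁ (col b (∁ S)) a                           ≤⟨ ℕP.m≤n+m _ _ ⟩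
        δ G₂ (row a (∁ S)) b ℕ.+ δ G₁ (col b (∁ S)) a  ≡⟨ δ-□ (∁ S) a b ⟨
        δ (G₁ □ G₂) (∁ S) (combine a b)                ∎
        where
        open ℕP.≤-Reasoning
        ∁A⊆col : ∁ A ⊆ col b (∁ S)
        ∁A⊆col rewrite col-∁ b S = p⊆q⇒∁p⊇∁q (col⊆shadow b S)

      inside-bound : ∀ a b → δ (G₁ □ G₂) S (combine a b) ≤ δ₂ ℕ.+ δ G₁ A a
      inside-bound a b = begin
        δ (G₁ □ G₂) S (combine a b)             ≡⟨ δ-□ S a b ⟩
        δ G₂ (row a S) b ℕ.+ δ G₁ (col b S) a   ≤⟨ ℕP.+-mono-≤ row≤δ₂ (δ-mono G₁ a (col⊆shadow b S)) ⟩
        δ₂ ℕ.+ δ G₁ A a                         ∎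
        where
        open ℕP.≤-Reasoning
        row≤δ₂ : δ G₂ (row a S) b ≤ δ₂
        row≤δ₂ = ℕP.≤-trans (δ≤deg G₂ (row a S) b) (ℕP.≤-reflexive (regular b))

      defends : ∀ a → a ∈ A → + δ G₁ (∁ A) a + (k - + δ₂) ℤ.≤ + δ G₁ A a
      defends a a∈A with shadow-elim a∈A
      ... | b , ab∈S = unshift-≤ (+ δ G₁ (∁ A) a) (+ δ G₁ A a) k (+ δ₂) (begin
        + δ G₁ (∁ A) a + k                     ≤⟨ ℤP.+-monoˡ-≤ k (ℤ.+≤+ (outside-bound a b)) ⟩
        + δ (G₁ □ G₂) (∁ S) (combine a b) + k  ≤⟨ S-defends (combine a b) ab∈S ⟩
        + δ (G₁ □ G₂) S (combine a b)          ≤⟨ ℤ.+≤+ (inside-bound a b) ⟩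
        + (δ₂ ℕ.+ δ G₁ A a)                    ∎)
        where open ℤP.≤-Reasoning

proposition9 : (G₁ G₂ : Graph) → Simple G₁ → Simple G₂ →
    1 ≤ n G₁ → 1 ≤ n G₂ →
    (δ₂ : ℕ) → Regular G₂ δ₂ →
    (S₁ : Subset (n G₁)) → (k : ℤ) →
    (+ δ₂) - (+ maxDeg G₁) Data.Integer.≤ k → k Data.Integer.≤ (+ maxDeg G₁) + (+ δ₂) →
    IsDaf (G₁ □ G₂) k (prodSet G₁ G₂ S₁) ⇔ IsDaf G₁ (k - (+ δ₂)) S₁
proposition9 G₁ G₂ _ (_ , loopless₂) _ V₂≢∅ δ₂ regular S₁ k _ _ = mk⇔ restrict extend
  where
  open Product G₁ G₂

  restrict : IsDaf (G₁ □ G₂) k (prodSet G₁ G₂ S₁) → IsDaf G₁ (k - + δ₂) S₁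
  restrict daf A A⊆S₁ A-alliance =
    daf (prodSet G₁ G₂ A) (prodSet-mono A⊆S₁) (lift-alliance loopless₂ regular V₂≢∅ {k} A-alliance)

  extend : IsDaf G₁ (k - + δ₂) S₁ → IsDaf (G₁ □ G₂) k (prodSet G₁ G₂ S₁)
  extend daf S S⊆S₁×V₂ S-alliance =
    daf (shadow S) (shadow-⊆ S⊆S₁×V₂) (shadow-alliance loopless₂ regular {k} S-alliance)
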